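{- Let $q$ be a power of an odd prime with $3\nmid q-1$, let $\lambda\in\mathbb{F}_q$ be a non-square, and let $a\in\mathbb{F}_q^*$. The graph $\mathcal{G}(\lambda,X^3+a)$ has a (weakly) connected component with exactly two vertices if and only if $\lambda\neq-1$ and $a=(\lambda+1)(\lambda-1)^2/8$. In particular, if $\lambda\neq-1$ and $a=(\lambda+1)(\lambda-1)^2/8$, then the vertices $(1-\lambda)/2$ and $(\lambda-1)/2$ form a connected component of $\mathcal{G}(\lambda,X^3+a)$.
   Context: For a polynomial $f\in\mathbb{F}_q[X]$ and a non-square $\lambda\in\mathbb{F}_q$, $\mathcal{G}(\lambda,f)$ is the directed graph with vertex set $\mathbb{F}_q$ and an edge from $x$ to $y$ iff $(y^2-f(x))(\lambda y^2-f(x))=0$ (loops allowed). -}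

module Defs where

open import Level using (0ℓ)
open import Data.Nat using (ℕ; zero; suc) renaming (_*_ to _*ℕ_; _^_ to _^ℕ_)
open import Data.Nat.Primality using (Prime)
open import Data.Fin using (Fin)
open import Data.Product using (Σ; ∃; _×_; _,_)
open import Data.Sum using (_⊎_)
open import Relation.Nullary using (¬_)
open import Relation.Binary.PropositionalEquality using (_≡_)
open import Relation.Binary.Construct.Closure.Equivalence using (EqClosure)
open import Algebra.Structures using (IsCommutativeRing)
open import Function.Bundles using (_↔_)

IsOddPrimePower : ℕ → Set
IsOddPrimePower q = Σ ℕ λ p → Σ ℕ λ k →
  Prime p × (¬ (Σ ℕ λ m → p ≡ 2 *ℕ m)) × q ≡ p ^ℕ (suc k)

record FiniteField (q : ℕ) : Set₁ where
  infixl 7 _*_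
  infixl 6 _+_ _-_
  field
    Carrier : Set
    _+_ _*_ : Carrier → Carrier → Carrier
    -_      : Carrier → Carrier
    0# 1#   : Carrier
    isCommutativeRing : IsCommutativeRing _≡_ _+_ _*_ -_ 0# 1#
    0≢1     : ¬ (0# ≡ 1#)
    _⁻¹     : Carrier → Carrier
    ⁻¹-inverse : ∀ x → ¬ (x ≡ 0#) → x * (x ⁻¹) ≡ 1#
    enumeration : Fin q ↔ Carrier

  _-_ : Carrier → Carrier → Carrier
  x - y = x + (- y)

  2# : Carrier
  2# = 1# + 1#

  8# : Carrier
  8# = 2# * 2# * 2#

  _/_ : Carrier → Carrier → Carrier
  x / y = x * (y ⁻¹)

  IsSquare : Carrier → Set
  IsSquare x = ∃ λ y → y * y ≡ x

  Edge : Carrier → (Carrier → Carrier) → Carrier → Carrier → Set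
  Edge λ' f x y = (y * y - f x) * (λ' * (y * y) - f x) ≡ 0#

  WeaklyConnected : Carrier → (Carrier → Carrier) → Carrier → Carrier → Set
  WeaklyConnected λ' f = EqClosure (Edge λ' f)

  IsTwoVertexComponent : Carrier → (Carrier → Carrier) → Carrier → Carrier → Set
  IsTwoVertexComponent λ' f u v =
    ¬ (u ≡ v) × (∀ w → (WeaklyConnected λ' f u w → (w ≡ u ⊎ w ≡ v))
                      × ((w ≡ u ⊎ w ≡ v) → WeaklyConnected λ' f u w))

  HasTwoVertexComponent : Carrier → (Carrier → Carrier) → Set
  HasTwoVertexComponent λ' f = ∃ λ u → ∃ λ v → IsTwoVertexComponent λ' f u v

-- Put f x = x³ + a. Since 3 ∤ q − 1 there is no cube root of unity besides 1, so f is a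
-- bijection, and x → y is an edge exactly when f x ∈ {y², λ y²}. As λ is a non-square, the
-- sets {y², λ y²} and {t², λ t²} with t ≠ 0 meet only when y² = t². If {u , v} is a component,
-- it cannot contain 0 (the preimages of 0, x₀² and λ x₀² would be three vertices), and for
-- y ∈ {u , v} the preimages of y² and λ y² are u and v; comparing y = u with y = v gives
-- v = − u and a t ∈ {u , v} with f t = t², f (− t) = λ t². Conversely such a t makes
-- {t , − t} a component. Adding and subtracting the two equations gives 2 a = (1 + λ) t² and
-- 2 t = 1 − λ, which is the stated value of a, with t = (1 − λ) / 2. Both 2 ≠ 0 and
-- 3 ∤ q − 1 are used through orbit counting: a fixed-point-free permutation of prime period p
-- splits a finite set into p-element orbits.

module Submission where

open import Defs
open import Level using (0ℓ)
open import Data.Nat as ℕ using (ℕ; zero; suc; _∸_; _<_)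
import Data.Nat.Properties as ℕ
open import Data.Nat.Divisibility using (_∣_; _∣0; ∣-refl; ∣m∣n⇒∣m+n)
open import Data.Nat.GeneralisedArithmetic using (iterate)
open import Data.Nat.Induction using (<-wellFounded)
open import Data.Nat.Primality using (Prime; euclidsLemma; prime[2])
open import Data.Fin.Properties using (inj⇒≟)
open import Data.Product using (_×_; _,_; proj₁; proj₂; ∃)
open import Data.Product.Properties using (≡-dec)
open import Data.Sum using (_⊎_; inj₁; inj₂)
open import Data.Empty using (⊥)
open import Data.Maybe using (Maybe; just; nothing)
open import Data.List as List using (List; []; _∷_; [_]; _++_; length; filter; tabulate; map)
open import Data.List.Properties using (length-++; length-iterate; length-tabulate; length-map)
open import Data.List.Membership.Propositional using (_∈_; _∉_)
open import Data.List.Membership.Propositional.Properties using (∈-++⁺ˡ; ∈-++⁺ʳ; ∈-++⁻; ∈-filter⁺; ∈-filter⁻; ∈-tabulate⁺; ∈-map⁻)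
open import Data.List.Membership.Propositional.Properties.WithK using (unique∧set⇒bag)
open import Data.List.Relation.Binary.Subset.Propositional using (_⊆_)
open import Data.List.Relation.Binary.BagAndSetEquality using (∼bag⇒↭)
open import Data.List.Relation.Binary.Permutation.Propositional.Properties using (↭-length)
open import Data.List.Relation.Unary.Any using (here; there)
open import Data.List.Relation.Unary.All as All using ([]; _∷_)
open import Data.List.Relation.Unary.AllPairs using ([]; _∷_)
open import Data.List.Relation.Unary.Unique.Propositional using (Unique)
import Data.List.Relation.Unary.Unique.Propositional.Properties as Unique
open import Function.Base using (id; _∘_)
open import Function.Bundles using (_⇔_; mk⇔; Equivalence; Inverse; Injection)
open import Function.Properties.Inverse using (↔-sym; ↔⇒↣)
open import Induction.WellFounded using (Acc; acc)
open import Algebra.Bundles using (CommutativeRing; RawRing)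
open import Algebra.Structures using (IsCommutativeRing)
open import Algebra.Solver.Ring.AlmostCommutativeRing using (fromCommutativeRing; _-Raw-AlmostCommutative⟶_)
import Algebra.Solver.Ring
open import Relation.Nullary using (¬_; yes; no; ¬?; contradiction)
open import Relation.Binary.Core using (Rel)
open import Relation.Binary.Definitions using (DecidableEquality)
open import Relation.Binary.PropositionalEquality as ≡
  using (_≡_; _≢_; refl; sym; trans; cong; cong₂; subst; module ≡-Reasoning)
open import Relation.Binary.Construct.Closure.Equivalence using (EqClosure)
open import Relation.Binary.Construct.Closure.ReflexiveTransitive as Star using (ε; _◅_; _◅◅_)
open import Relation.Binary.Construct.Closure.Symmetric using (SymClosure; fwd; bwd)

module IntegerCoefficientSolver {c ℓ} (R : CommutativeRing c ℓ) where
  open CommutativeRing R renaming (refl to ≈-refl; sym to ≈-sym; trans to ≈-trans)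
  open import Algebra.Properties.Ring ring using (-0#≈0#; -‿+-comm; -‿anti-homo-+; -‿involutive; x[y-z]≈xy-xz; [y-z]x≈yx-zx)
  open import Algebra.Properties.CommutativeSemigroup +-commutativeSemigroup using (interchange)
  open import Algebra.Properties.Semiring.Mult.TCOptimised semiring renaming (_×_ to _×′_) using (1+×; ×-homo-+; ×1-homo-*)
  open import Relation.Binary.Reasoning.Setoid setoid

  private
    -- Integer coefficients: (m , n) stands for m − n and is kept with one component zero.
    -- The solver compares normal forms by refl, so coefficients must compute and equal
    -- integers must have equal codes.
    Diff : Set
    Diff = ℕ × ℕ

    normalise : ℕ → ℕ → Diff
    normalise m n = m ∸ n , n ∸ m

    diffRing : RawRing 0ℓ 0ℓ
    diffRing = record
      { Carrier = Diff
      ; _≈_ = _≡_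
      ; _+_ = λ { (a , b) (c , d) → normalise (a ℕ.+ c) (b ℕ.+ d) }
      ; _*_ = λ { (a , b) (c , d) → normalise (a ℕ.* c ℕ.+ b ℕ.* d) (a ℕ.* d ℕ.+ b ℕ.* c) }
      ; -_ = λ { (a , b) → b , a }
      ; 0# = 0 , 0
      ; 1# = 1 , 0
      }

    -- Evaluated by cases, not as m × 1# - n × 1#, so that # 2 is definitionally 1# + 1#.
    ⟦_⟧ : Diff → Carrier
    ⟦ m , zero ⟧ = m ×′ 1#
    ⟦ zero , suc n ⟧ = - (suc n ×′ 1#)
    ⟦ suc m , suc n ⟧ = ⟦ m , n ⟧

    ⟦_⟧′ : Diff → Carrier
    ⟦ m , n ⟧′ = m ×′ 1# + - (n ×′ 1#)

    sub-interchange : ∀ x y z w → (x + y) + - (z + w) ≈ (x + - z) + (y + - w)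
    sub-interchange x y z w = begin
      (x + y) + - (z + w)     ≈⟨ +-congˡ (≈-sym (-‿+-comm z w)) ⟩
      (x + y) + (- z + - w)   ≈⟨ interchange x y (- z) (- w) ⟩
      (x + - z) + (y + - w)   ∎

    ⟦⟧≈⟦⟧′ : ∀ d → ⟦ d ⟧ ≈ ⟦ d ⟧′
    ⟦⟧≈⟦⟧′ (m , zero) = ≈-sym (≈-trans (+-congˡ -0#≈0#) (+-identityʳ _))
    ⟦⟧≈⟦⟧′ (zero , suc n) = ≈-sym (+-identityˡ _)
    ⟦⟧≈⟦⟧′ (suc m , suc n) = begin
      ⟦ m , n ⟧                                       ≈⟨ ⟦⟧≈⟦⟧′ (m , n) ⟩
      ⟦ m , n ⟧′                                      ≈⟨ +-identityˡ _ ⟨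
      0# + ⟦ m , n ⟧′                                 ≈⟨ +-congʳ (-‿inverseʳ 1#) ⟨
      (1# + - 1#) + ⟦ m , n ⟧′                        ≈⟨ sub-interchange 1# (m ×′ 1#) 1# (n ×′ 1#) ⟨
      (1# + m ×′ 1#) + - (1# + n ×′ 1#)               ≈⟨ +-cong (1+× m 1#) (-‿cong (1+× n 1#)) ⟨
      ⟦ suc m , suc n ⟧′                              ∎

    ⟦normalise⟧ : ∀ m n → ⟦ normalise m n ⟧ ≡ ⟦ m , n ⟧
    ⟦normalise⟧ zero zero = ≡.refl
    ⟦normalise⟧ zero (suc n) = ≡.refl
    ⟦normalise⟧ (suc m) zero = ≡.refl
    ⟦normalise⟧ (suc m) (suc n) = ⟦normalise⟧ m n

    ⟦normalise⟧′ : ∀ m n → ⟦ normalise m n ⟧ ≈ ⟦ m , n ⟧′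
    ⟦normalise⟧′ m n = ≈-trans (reflexive (⟦normalise⟧ m n)) (⟦⟧≈⟦⟧′ (m , n))

    +-homo : ∀ x y → ⟦ RawRing._+_ diffRing x y ⟧ ≈ ⟦ x ⟧ + ⟦ y ⟧
    +-homo (a , b) (c , d) = begin
      ⟦ normalise (a ℕ.+ c) (b ℕ.+ d) ⟧                     ≈⟨ ⟦normalise⟧′ (a ℕ.+ c) (b ℕ.+ d) ⟩
      (a ℕ.+ c) ×′ 1# + - ((b ℕ.+ d) ×′ 1#)                ≈⟨ +-cong (×-homo-+ 1# a c) (-‿cong (×-homo-+ 1# b d)) ⟩
      (a ×′ 1# + c ×′ 1#) + - (b ×′ 1# + d ×′ 1#)          ≈⟨ sub-interchange _ _ _ _ ⟩
      ⟦ a , b ⟧′ + ⟦ c , d ⟧′                              ≈⟨ +-cong (⟦⟧≈⟦⟧′ (a , b)) (⟦⟧≈⟦⟧′ (c , d)) ⟨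
      ⟦ a , b ⟧ + ⟦ c , d ⟧                                ∎

    *-homo : ∀ x y → ⟦ RawRing._*_ diffRing x y ⟧ ≈ ⟦ x ⟧ * ⟦ y ⟧
    *-homo (a , b) (c , d) = begin
      ⟦ normalise (a ℕ.* c ℕ.+ b ℕ.* d) (a ℕ.* d ℕ.+ b ℕ.* c) ⟧
        ≈⟨ ⟦normalise⟧′ (a ℕ.* c ℕ.+ b ℕ.* d) (a ℕ.* d ℕ.+ b ℕ.* c) ⟩
      (a ℕ.* c ℕ.+ b ℕ.* d) ×′ 1# + - ((a ℕ.* d ℕ.+ b ℕ.* c) ×′ 1#)
        ≈⟨ +-cong (×·-homo a c b d) (-‿cong (×·-homo a d b c)) ⟩
      (A * C + B * D) + - (A * D + B * C)                      ≈⟨ sub-interchange _ _ _ _ ⟩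
      (A * C + - (A * D)) + (B * D + - (B * C))
        ≈⟨ +-congˡ (≈-sym (≈-trans (-‿anti-homo-+ (B * C) (- (B * D))) (+-congʳ (-‿involutive (B * D))))) ⟩
      (A * C + - (A * D)) + - (B * C + - (B * D))             ≈⟨ +-cong (x[y-z]≈xy-xz A C D) (-‿cong (x[y-z]≈xy-xz B C D)) ⟨
      A * (C + - D) + - (B * (C + - D))                        ≈⟨ [y-z]x≈yx-zx (C + - D) A B ⟨
      (A + - B) * (C + - D)                                    ≈⟨ *-cong (⟦⟧≈⟦⟧′ (a , b)) (⟦⟧≈⟦⟧′ (c , d)) ⟨
      ⟦ a , b ⟧ * ⟦ c , d ⟧                                    ∎
      where
      A = a ×′ 1#
      B = b ×′ 1#
      C = c ×′ 1#
      D = d ×′ 1#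
      ×·-homo : ∀ m n k l → (m ℕ.* n ℕ.+ k ℕ.* l) ×′ 1# ≈ m ×′ 1# * n ×′ 1# + k ×′ 1# * l ×′ 1#
      ×·-homo m n k l = ≈-trans (×-homo-+ 1# (m ℕ.* n) (k ℕ.* l)) (+-cong (×1-homo-* m n) (×1-homo-* k l))

    -‿homo : ∀ x → ⟦ RawRing.-_ diffRing x ⟧ ≈ - ⟦ x ⟧
    -‿homo (a , b) = begin
      ⟦ b , a ⟧                        ≈⟨ ⟦⟧≈⟦⟧′ (b , a) ⟩
      B + - A                          ≈⟨ +-congʳ (-‿involutive B) ⟨
      - - B + - A                      ≈⟨ -‿anti-homo-+ A (- B) ⟨
      - ⟦ a , b ⟧′                     ≈⟨ -‿cong (⟦⟧≈⟦⟧′ (a , b)) ⟨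
      - ⟦ a , b ⟧                      ∎
      where
      A = a ×′ 1#
      B = b ×′ 1#

    homomorphism : diffRing -Raw-AlmostCommutative⟶ fromCommutativeRing R
    homomorphism = record
      { ⟦_⟧ = ⟦_⟧ ; +-homo = +-homo ; *-homo = *-homo ; -‿homo = -‿homo
      ; 0-homo = ≈-refl ; 1-homo = ≈-refl }

    _≟ᵈ_ : ∀ x y → Maybe (⟦ x ⟧ ≈ ⟦ y ⟧)
    x ≟ᵈ y with ≡-dec ℕ._≟_ ℕ._≟_ x y
    ... | yes x≡y = just (reflexive (≡.cong ⟦_⟧ x≡y))
    ... | no _ = nothing

  private
    module Solver = Algebra.Solver.Ring diffRing (fromCommutativeRing R) homomorphism _≟ᵈ_
  open Solver public using (Polynomial; solve; _:=_; _:+_; _:*_; :-_; _:-_)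

  infix 10 #_
  #_ : ∀ {n} → ℕ → Polynomial n
  # k = Solver.con (k , 0)

module ListDifference {A : Set} (_≟_ : DecidableEquality A) where
  open import Data.List.Membership.DecPropositional _≟_ using (_∈?_)

  infixl 6 _∖_
  _∖_ : List A → List A → List A
  xs ∖ ys = filter (λ z → ¬? (z ∈? ys)) xs

  ∈-∖⁺ : ∀ {z xs ys} → z ∈ xs → z ∉ ys → z ∈ xs ∖ ys
  ∈-∖⁺ = ∈-filter⁺ (λ z → ¬? (z ∈? _))

  ∈-∖⁻ : ∀ {z} xs ys → z ∈ xs ∖ ys → z ∈ xs × z ∉ ys
  ∈-∖⁻ _ _ = ∈-filter⁻ (λ z → ¬? (z ∈? _))

  ∖-unique : ∀ {xs} ys → Unique xs → Unique (xs ∖ ys)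
  ∖-unique ys = Unique.filter⁺ (λ z → ¬? (z ∈? ys))

  length-∖ : ∀ {xs ys} → Unique xs → Unique ys → ys ⊆ xs → length xs ≡ length ys ℕ.+ length (xs ∖ ys)
  length-∖ {xs} {ys} xs! ys! ys⊆xs = begin
    length xs                  ≡⟨ ↭-length (∼bag⇒↭ (unique∧set⇒bag xs! split! (mk⇔ split merge))) ⟩
    length (ys ++ xs ∖ ys)     ≡⟨ length-++ ys ⟩
    length ys ℕ.+ length (xs ∖ ys) ∎
    where
    open ≡-Reasoning
    split : ∀ {z} → z ∈ xs → z ∈ ys ++ xs ∖ ys
    split {z} z∈xs with z ∈? ys
    ... | yes z∈ys = ∈-++⁺ˡ z∈ys
    ... | no z∉ys = ∈-++⁺ʳ ys (∈-∖⁺ z∈xs z∉ys)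
    merge : ∀ {z} → z ∈ ys ++ xs ∖ ys → z ∈ xs
    merge z∈ with ∈-++⁻ ys z∈
    ... | inj₁ z∈ys = ys⊆xs z∈ys
    ... | inj₂ z∈xs∖ys = proj₁ (∈-∖⁻ xs ys z∈xs∖ys)
    split! : Unique (ys ++ xs ∖ ys)
    split! = Unique.++⁺ ys! (∖-unique ys xs!) λ (z∈ys , z∈xs∖ys) → proj₂ (∈-∖⁻ xs ys z∈xs∖ys) z∈ys

module OrbitCounting {A : Set} (_≟_ : DecidableEquality A) (σ : A → A)
  (σ-injective : ∀ {x y} → σ x ≡ σ y → x ≡ y)
  (n : ℕ) (σ-periodic : ∀ x → σ (iterate σ x n) ≡ x) where
  open ListDifference _≟_

  orbit : A → List A
  orbit x = List.iterate σ x (suc n)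

  Closed : List A → Set
  Closed xs = ∀ {x} → x ∈ xs → σ x ∈ xs

  private
    iterate-∈-iterate : ∀ m x → iterate σ x m ∈ List.iterate σ x (suc m)
    iterate-∈-iterate zero x = here refl
    iterate-∈-iterate (suc m) x = there (iterate-∈-iterate m (σ x))

    σ-∈-iterate⁻ : ∀ m {x y} → σ y ∈ List.iterate σ (σ x) m → y ∈ List.iterate σ x (suc m)
    σ-∈-iterate⁻ (suc m) (here σy≡σx) = here (σ-injective σy≡σx)
    σ-∈-iterate⁻ (suc m) (there σy∈) = there (σ-∈-iterate⁻ m σy∈)

    iterate-⊆ : ∀ {xs} → Closed xs → ∀ m {x} → x ∈ xs → List.iterate σ x m ⊆ xs
    iterate-⊆ closed (suc m) x∈xs (here refl) = x∈xs
    iterate-⊆ closed (suc m) x∈xs (there y∈) = iterate-⊆ closed m (closed x∈xs) y∈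

    σ-∈-orbit⁻ : ∀ {x y} → σ y ∈ orbit x → y ∈ orbit x
    σ-∈-orbit⁻ {x} (here σy≡x) =
      subst (_∈ orbit x) (σ-injective (trans (σ-periodic x) (sym σy≡x))) (iterate-∈-iterate n x)
    σ-∈-orbit⁻ (there σy∈) = σ-∈-iterate⁻ n σy∈

    orbit-⊆ : ∀ {xs} → Closed xs → ∀ {x} → x ∈ xs → orbit x ⊆ xs
    orbit-⊆ closed = iterate-⊆ closed (suc n)

  suc[n]∣length : ∀ xs → Unique xs → Closed xs → (∀ {x} → x ∈ xs → Unique (orbit x)) → suc n ∣ length xs
  suc[n]∣length xs = go xs (<-wellFounded (length xs))
    where
    go : ∀ xs → Acc _<_ (length xs) → Unique xs → Closed xs → (∀ {x} → x ∈ xs → Unique (orbit x)) →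
         suc n ∣ length xs
    go [] _ _ _ _ = suc n ∣0
    -- Removing the orbit of x leaves a closed list, as σ y ∈ orbit x forces y ∈ orbit x.
    go xs@(x ∷ _) (acc rec) xs! closed orbit! = subst (suc n ∣_) (sym length-xs) (∣m∣n⇒∣m+n ∣-refl suc[n]∣rest)
      where
      rest = xs ∖ orbit x
      length-xs : length xs ≡ suc n ℕ.+ length rest
      length-xs = trans (length-∖ xs! (orbit! (here refl)) (orbit-⊆ closed (here refl)))
                        (cong (ℕ._+ length rest) (length-iterate σ x (suc n)))
      rest<xs : length rest < length xs
      rest<xs = subst (length rest <_) (sym length-xs) (ℕ.m<n+m (length rest) (ℕ.s≤s ℕ.z≤n))
      rest-closed : Closed rest
      rest-closed y∈ with ∈-∖⁻ xs (orbit x) y∈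
      ... | y∈xs , y∉orbit = ∈-∖⁺ (closed y∈xs) (λ σy∈ → y∉orbit (σ-∈-orbit⁻ σy∈))
      suc[n]∣rest : suc n ∣ length rest
      suc[n]∣rest = go rest (rec rest<xs) (∖-unique (orbit x) xs!) rest-closed (orbit! ∘ proj₁ ∘ ∈-∖⁻ xs (orbit x))

EqClosure-preserves : ∀ {A : Set} {ℓ} {R : Rel A ℓ} (S : A → Set) →
  (∀ {x y} → R x y → S x → S y) → (∀ {x y} → R x y → S y → S x) →
  ∀ {x y} → EqClosure R x y → S x → S y
EqClosure-preserves {R = R} S forward backward = Star.fold (λ x y → S x → S y) step id
  where
  step : ∀ {x y z} → SymClosure R x y → (S y → S z) → S x → S z
  step (fwd r) k = k ∘ forward r
  step (bwd r) k = k ∘ backward r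

module _ {A : Set} {u v : A} where

  distinct-pair-members : ∀ {a b} → (a ≡ u ⊎ a ≡ v) → (b ≡ u ⊎ b ≡ v) → a ≢ b →
                          (a ≡ u × b ≡ v) ⊎ (a ≡ v × b ≡ u)
  distinct-pair-members (inj₁ refl) (inj₁ refl) a≢b = contradiction refl a≢b
  distinct-pair-members (inj₁ a≡u) (inj₂ b≡v) _ = inj₁ (a≡u , b≡v)
  distinct-pair-members (inj₂ a≡v) (inj₁ b≡u) _ = inj₂ (a≡v , b≡u)
  distinct-pair-members (inj₂ refl) (inj₂ refl) a≢b = contradiction refl a≢b

  pair-has-no-three-distinct : ∀ {a b c} → (a ≡ u ⊎ a ≡ v) → (b ≡ u ⊎ b ≡ v) → (c ≡ u ⊎ c ≡ v) →
    a ≢ b → a ≢ c → b ≢ c → ⊥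
  pair-has-no-three-distinct (inj₁ refl) (inj₁ refl) _ a≢b _ _ = a≢b refl
  pair-has-no-three-distinct (inj₂ refl) (inj₂ refl) _ a≢b _ _ = a≢b refl
  pair-has-no-three-distinct (inj₁ refl) (inj₂ refl) (inj₁ refl) _ a≢c _ = a≢c refl
  pair-has-no-three-distinct (inj₁ refl) (inj₂ refl) (inj₂ refl) _ _ b≢c = b≢c refl
  pair-has-no-three-distinct (inj₂ refl) (inj₁ refl) (inj₁ refl) _ _ b≢c = b≢c refl
  pair-has-no-three-distinct (inj₂ refl) (inj₁ refl) (inj₂ refl) _ a≢c _ = a≢c refl

prime∣p^suc⇒prime∣p : ∀ {r p} → Prime r → ∀ k → r ∣ p ℕ.^ suc k → r ∣ p
prime∣p^suc⇒prime∣p {p = p} r-prime zero r∣p = subst (_ ∣_) (ℕ.*-identityʳ p) r∣p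
prime∣p^suc⇒prime∣p {p = p} r-prime (suc k) r∣p^2+k with euclidsLemma p (p ℕ.^ suc k) r-prime r∣p^2+k
... | inj₁ r∣p = r∣p
... | inj₂ r∣p^1+k = prime∣p^suc⇒prime∣p r-prime k r∣p^1+k

odd-prime-power⇒odd : ∀ {q} → IsOddPrimePower q → ¬ 2 ∣ q
odd-prime-power⇒odd (p , k , _ , p-odd , refl) 2∣q = p-odd (quotient , trans equality (ℕ.*-comm quotient 2))
  where open _∣_ (prime∣p^suc⇒prime∣p {p = p} prime[2] k 2∣q)

module FiniteFieldProperties {q : ℕ} (F : FiniteField q) where
  open FiniteField F
  open IsCommutativeRing isCommutativeRing
    using (+-assoc; +-comm; +-identityˡ; +-identityʳ; -‿inverseʳ; *-comm; *-identityˡ; *-identityʳ; zeroˡ; zeroʳ)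

  commutativeRing : CommutativeRing 0ℓ 0ℓ
  commutativeRing = record { isCommutativeRing = isCommutativeRing }

  open CommutativeRing commutativeRing using (ring; +-group)
  open import Algebra.Properties.Ring ring using (-‿involutive; -0#≈0#; +-cancelˡ; +-cancelʳ)
  open import Algebra.Properties.Group +-group using (x∙y⁻¹≈ε⇒x≈y; x≈y⇒x∙y⁻¹≈ε)
  open IntegerCoefficientSolver commutativeRing
  open ≡-Reasoning

  _≟_ : DecidableEquality Carrier
  _≟_ = inj⇒≟ (↔⇒↣ (↔-sym enumeration))

  x*y≡0⇒x≡0⊎y≡0 : ∀ {x y} → x * y ≡ 0# → x ≡ 0# ⊎ y ≡ 0#
  x*y≡0⇒x≡0⊎y≡0 {x} {y} xy≡0 with x ≟ 0#
  ... | yes x≡0 = inj₁ x≡0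
  ... | no x≢0 = inj₂ (begin
    y                ≡⟨ *-identityˡ y ⟨
    1# * y           ≡⟨ cong (_* y) (⁻¹-inverse x x≢0) ⟨
    x * x ⁻¹ * y     ≡⟨ solve 3 (λ x i y → x :* i :* y := i :* (x :* y)) refl x (x ⁻¹) y ⟩
    x ⁻¹ * (x * y)   ≡⟨ cong (x ⁻¹ *_) xy≡0 ⟩
    x ⁻¹ * 0#        ≡⟨ zeroʳ _ ⟩
    0#               ∎)

  x≢0∧y≢0⇒x*y≢0 : ∀ {x y} → x ≢ 0# → y ≢ 0# → x * y ≢ 0#
  x≢0∧y≢0⇒x*y≢0 x≢0 y≢0 xy≡0 with x*y≡0⇒x≡0⊎y≡0 xy≡0
  ... | inj₁ x≡0 = x≢0 x≡0
  ... | inj₂ y≡0 = y≢0 y≡0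

  x-y≡0⇒x≡y : ∀ {x y} → x - y ≡ 0# → x ≡ y
  x-y≡0⇒x≡y = x∙y⁻¹≈ε⇒x≈y _ _

  x≡y⇒x-y≡0 : ∀ {x y} → x ≡ y → x - y ≡ 0#
  x≡y⇒x-y≡0 = x≈y⇒x∙y⁻¹≈ε

  -x*-x≡x*x : ∀ x → - x * - x ≡ x * x
  -x*-x≡x*x = solve 1 (λ x → :- x :* :- x := x :* x) refl

  x≢0⇒-x≢0 : ∀ {x} → x ≢ 0# → - x ≢ 0#
  x≢0⇒-x≢0 {x} x≢0 -x≡0 = x≢0 (trans (sym (-‿involutive x)) (trans (cong -_ -x≡0) -0#≈0#))

  *-cancelˡ : ∀ {x y z} → x ≢ 0# → x * y ≡ x * z → y ≡ z
  *-cancelˡ {x} {y} {z} x≢0 xy≡xz with x*y≡0⇒x≡0⊎y≡0 x[y-z]≡0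
    where
    x[y-z]≡0 : x * (y - z) ≡ 0#
    x[y-z]≡0 = trans (solve 3 (λ x y z → x :* (y :- z) := x :* y :- x :* z) refl x y z) (x≡y⇒x-y≡0 xy≡xz)
  ... | inj₁ x≡0 = contradiction x≡0 x≢0
  ... | inj₂ y-z≡0 = x-y≡0⇒x≡y y-z≡0

  x*x≡y*y⇒x≡y⊎x≡-y : ∀ {x y} → x * x ≡ y * y → x ≡ y ⊎ x ≡ - y
  x*x≡y*y⇒x≡y⊎x≡-y {x} {y} xx≡yy with x*y≡0⇒x≡0⊎y≡0 [x-y][x+y]≡0
    where
    [x-y][x+y]≡0 : (x - y) * (x + y) ≡ 0#
    [x-y][x+y]≡0 = trans (solve 2 (λ x y → (x :- y) :* (x :+ y) := x :* x :- y :* y) refl x y) (x≡y⇒x-y≡0 xx≡yy)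
  ... | inj₁ x-y≡0 = inj₁ (x-y≡0⇒x≡y x-y≡0)
  ... | inj₂ x+y≡0 = inj₂ (x-y≡0⇒x≡y (trans (cong (x +_) (-‿involutive y)) x+y≡0))

  elements : List Carrier
  elements = tabulate (Inverse.to enumeration)

  elements-unique : Unique elements
  elements-unique = Unique.tabulate⁺ (Injection.injective (↔⇒↣ enumeration))

  ∈-elements : ∀ x → x ∈ elements
  ∈-elements x = subst (_∈ elements) (Inverse.inverseˡ enumeration refl) (∈-tabulate⁺ (Inverse.from enumeration x))

  length-elements : length elements ≡ q
  length-elements = length-tabulate _

  open ListDifference _≟_
  open import Data.List.Membership.DecPropositional _≟_ using (_∈?_)

  injective⇒surjective : ∀ {f : Carrier → Carrier} → (∀ {x y} → f x ≡ f y → x ≡ y) → ∀ y → ∃ λ x → f x ≡ y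
  injective⇒surjective {f} f-injective y with y ∈? map f elements
  ... | yes y∈image = let x , _ , y≡fx = ∈-map⁻ f y∈image in x , sym y≡fx
  ... | no y∉image = contradiction too-long (ℕ.m≢1+m+n q)
    where
    image = y ∷ map f elements
    too-long : q ≡ suc (q ℕ.+ length (elements ∖ image))
    too-long = begin
      q                                                   ≡⟨ length-elements ⟨
      length elements                                     ≡⟨ length-∖ elements-unique image-unique (λ {z} _ → ∈-elements z) ⟩
      length image ℕ.+ length (elements ∖ image)
        ≡⟨ cong (λ n → suc n ℕ.+ length (elements ∖ image)) (trans (length-map f elements) length-elements) ⟩
      suc (q ℕ.+ length (elements ∖ image))               ∎
      where
      image-unique : Unique image
      image-unique = All.tabulate (λ z∈ y≡z → y∉image (subst (_∈ map f elements) (sym y≡z) z∈))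
                     ∷ Unique.map⁺ f-injective elements-unique

  2#≡0#⇒2∣q : 2# ≡ 0# → 2 ∣ q
  2#≡0#⇒2∣q 2≡0 = subst (2 ∣_) length-elements
    (suc[n]∣length elements elements-unique (λ {x} _ → ∈-elements (x + 1#)) (λ {x} _ → orbit-unique x))
    where
    x+1+1≡x : ∀ x → x + 1# + 1# ≡ x
    x+1+1≡x x = begin
      x + 1# + 1#  ≡⟨ +-assoc x 1# 1# ⟩
      x + 2#       ≡⟨ cong (x +_) 2≡0 ⟩
      x + 0#       ≡⟨ +-identityʳ x ⟩
      x            ∎
    open OrbitCounting _≟_ (_+ 1#) (+-cancelʳ _ _ _) 1 x+1+1≡x
    orbit-unique : ∀ x → Unique (orbit x)
    orbit-unique x = ((λ x≡x+1 → 0≢1 (+-cancelˡ x 0# 1# (trans (+-identityʳ x) x≡x+1))) ∷ []) ∷ [] ∷ []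

  cube-root-of-unity⇒3∣q∸1 : ∀ {w} → w * w * w ≡ 1# → w ≢ 1# → 3 ∣ q ∸ 1
  cube-root-of-unity⇒3∣q∸1 {w} w³≡1 w≢1 =
    subst (3 ∣_) length-nonzero (suc[n]∣length nonzero (∖-unique [ 0# ] elements-unique) closed orbit-unique)
    where
    w≢0 : w ≢ 0#
    w≢0 w≡0 = 0≢1 (trans (sym (trans (cong (λ w → w * w * w) w≡0) (zeroʳ _))) w³≡1)
    w[w[wx]]≡x : ∀ x → w * (w * (w * x)) ≡ x
    w[w[wx]]≡x x = begin
      w * (w * (w * x)) ≡⟨ solve 2 (λ w x → w :* (w :* (w :* x)) := w :* w :* w :* x) refl w x ⟩
      w * w * w * x     ≡⟨ cong (_* x) w³≡1 ⟩
      1# * x            ≡⟨ *-identityˡ x ⟩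
      x                 ∎
    open OrbitCounting _≟_ (w *_) (*-cancelˡ w≢0) 2 w[w[wx]]≡x
    nonzero = elements ∖ [ 0# ]
    length-nonzero : length nonzero ≡ q ∸ 1
    length-nonzero = cong (_∸ 1) (trans (sym (length-∖ elements-unique ([] ∷ []) λ { (here refl) → ∈-elements 0# })) length-elements)
    ∈-nonzero⁻ : ∀ {x} → x ∈ nonzero → x ≢ 0#
    ∈-nonzero⁻ x∈ x≡0 = proj₂ (∈-∖⁻ elements [ 0# ] x∈) (here x≡0)
    closed : Closed nonzero
    closed {x} x∈ = ∈-∖⁺ (∈-elements (w * x)) λ { (here wx≡0) → x≢0∧y≢0⇒x*y≢0 w≢0 (∈-nonzero⁻ x∈) wx≡0 }
    x≢wx : ∀ {x} → x ≢ 0# → x ≢ w * x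
    x≢wx {x} x≢0 x≡wx = w≢1 (sym (*-cancelˡ x≢0 (trans (*-identityʳ x) (trans x≡wx (*-comm w x)))))
    orbit-unique : ∀ {x} → x ∈ nonzero → Unique (orbit x)
    orbit-unique {x} x∈ =
      (x≢wx x≢0 ∷ (λ x≡wwx → x≢wx x≢0 (sym (trans (cong (w *_) x≡wwx) (w[w[wx]]≡x x)))) ∷ [])
      ∷ ((λ wx≡wwx → x≢wx x≢0 (*-cancelˡ w≢0 wx≡wwx)) ∷ []) ∷ [] ∷ []
      where x≢0 = ∈-nonzero⁻ x∈

  2#≢0# : IsOddPrimePower q → 2# ≢ 0#
  2#≢0# q-odd 2≡0 = odd-prime-power⇒odd q-odd (2#≡0#⇒2∣q 2≡0)

  x*x≡0⇒x≡0 : ∀ {x} → x * x ≡ 0# → x ≡ 0#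
  x*x≡0⇒x≡0 xx≡0 with x*y≡0⇒x≡0⊎y≡0 xx≡0
  ... | inj₁ x≡0 = x≡0
  ... | inj₂ x≡0 = x≡0

  cube-injective : ¬ 3 ∣ q ∸ 1 → ∀ {x y} → x * x * x ≡ y * y * y → x ≡ y
  cube-injective 3∤q-1 {x} {y} x³≡y³ with x ≟ y
  ... | yes x≡y = x≡y
  ... | no x≢y = contradiction (cube-root-of-unity⇒3∣q∸1 w³≡1 w≢1) 3∤q-1
    where
    y≢0 : y ≢ 0#
    y≢0 y≡0 with x*y≡0⇒x≡0⊎y≡0 (trans x³≡y³ (trans (cong (λ y → y * y * y) y≡0) (zeroʳ _)))
    ... | inj₁ xx≡0 = x≢y (trans (x*x≡0⇒x≡0 xx≡0) (sym y≡0))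
    ... | inj₂ x≡0 = x≢y (trans x≡0 (sym y≡0))
    w = x * y ⁻¹
    w³≡1 : w * w * w ≡ 1#
    w³≡1 = begin
      w * w * w                     ≡⟨ solve 2 (λ x i → (x :* i) :* (x :* i) :* (x :* i) := x :* x :* x :* (i :* i :* i)) refl x (y ⁻¹) ⟩
      x * x * x * (y ⁻¹ * y ⁻¹ * y ⁻¹) ≡⟨ cong (_* (y ⁻¹ * y ⁻¹ * y ⁻¹)) x³≡y³ ⟩
      y * y * y * (y ⁻¹ * y ⁻¹ * y ⁻¹) ≡⟨ solve 2 (λ y i → y :* y :* y :* (i :* i :* i) := (y :* i) :* (y :* i) :* (y :* i)) refl y (y ⁻¹) ⟩
      (y * y ⁻¹) * (y * y ⁻¹) * (y * y ⁻¹) ≡⟨ cong (λ e → e * e * e) (⁻¹-inverse y y≢0) ⟩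
      1# * 1# * 1#                  ≡⟨ trans (*-identityʳ _) (*-identityʳ _) ⟩
      1#                            ∎
    w≢1 : w ≢ 1#
    w≢1 w≡1 = x≢y (begin
      x                 ≡⟨ *-identityʳ x ⟨
      x * 1#            ≡⟨ cong (x *_) (⁻¹-inverse y y≢0) ⟨
      x * (y * y ⁻¹)    ≡⟨ solve 3 (λ x y i → x :* (y :* i) := x :* i :* y) refl x y (y ⁻¹) ⟩
      w * y             ≡⟨ cong (_* y) w≡1 ⟩
      1# * y            ≡⟨ *-identityˡ y ⟩
      y                 ∎)

  x≡y/z⇔z*x≡y : ∀ {x y z} → z ≢ 0# → (x ≡ y / z) ⇔ (z * x ≡ y)
  x≡y/z⇔z*x≡y {x} {y} {z} z≢0 = mk⇔ to from
    where
    to : x ≡ y / z → z * x ≡ y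
    to x≡y/z = begin
      z * x            ≡⟨ cong (z *_) x≡y/z ⟩
      z * (y * z ⁻¹)   ≡⟨ solve 3 (λ z y i → z :* (y :* i) := y :* (z :* i)) refl z y (z ⁻¹) ⟩
      y * (z * z ⁻¹)   ≡⟨ cong (y *_) (⁻¹-inverse z z≢0) ⟩
      y * 1#           ≡⟨ *-identityʳ y ⟩
      y                ∎
    from : z * x ≡ y → x ≡ y / z
    from zx≡y = begin
      x                ≡⟨ *-identityʳ x ⟨
      x * 1#           ≡⟨ cong (x *_) (⁻¹-inverse z z≢0) ⟨
      x * (z * z ⁻¹)   ≡⟨ solve 3 (λ x z i → x :* (z :* i) := z :* x :* i) refl x z (z ⁻¹) ⟩
      z * x * z ⁻¹     ≡⟨ cong (_* z ⁻¹) zx≡y ⟩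
      y / z            ∎

module NonSquareGraph {q : ℕ} (F : FiniteField q) {λ' : FiniteField.Carrier F}
  (λ-nonsquare : ¬ FiniteField.IsSquare F λ') where
  open FiniteField F
  open FiniteFieldProperties F
  open IntegerCoefficientSolver commutativeRing
  open IsCommutativeRing isCommutativeRing using (-‿inverseʳ; *-identityʳ; zeroˡ; zeroʳ)
  open import Algebra.Properties.Ring (CommutativeRing.ring commutativeRing) using (-‿involutive)
  open ≡-Reasoning

  λ≢0 : λ' ≢ 0#
  λ≢0 λ≡0 = λ-nonsquare (0# , trans (zeroˡ 0#) (sym λ≡0))

  λ≢1 : λ' ≢ 1#
  λ≢1 λ≡1 = λ-nonsquare (1# , trans (*-identityʳ 1#) (sym λ≡1))

  λ*y*y≡z*z⇒y≡0 : ∀ {y z} → λ' * (y * y) ≡ z * z → y ≡ 0#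
  λ*y*y≡z*z⇒y≡0 {y} {z} λyy≡zz with y ≟ 0#
  ... | yes y≡0 = y≡0
  ... | no y≢0 = contradiction (z * y ⁻¹ , (begin
    z * y ⁻¹ * (z * y ⁻¹)           ≡⟨ solve 2 (λ z i → z :* i :* (z :* i) := z :* z :* (i :* i)) refl z (y ⁻¹) ⟩
    z * z * (y ⁻¹ * y ⁻¹)           ≡⟨ cong (_* (y ⁻¹ * y ⁻¹)) λyy≡zz ⟨
    λ' * (y * y) * (y ⁻¹ * y ⁻¹)    ≡⟨ solve 3 (λ l y i → l :* (y :* y) :* (i :* i) := l :* ((y :* i) :* (y :* i))) refl λ' y (y ⁻¹) ⟩
    λ' * ((y * y ⁻¹) * (y * y ⁻¹))  ≡⟨ cong (λ e → λ' * (e * e)) (⁻¹-inverse y y≢0) ⟩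
    λ' * (1# * 1#)                  ≡⟨ trans (cong (λ' *_) (*-identityʳ 1#)) (*-identityʳ λ') ⟩
    λ'                              ∎)) λ-nonsquare

  λ*y*y≡z*z⇒z≡0 : ∀ {y z} → λ' * (y * y) ≡ z * z → z ≡ 0#
  λ*y*y≡z*z⇒z≡0 {y} {z} λyy≡zz = x*x≡0⇒x≡0 (begin
    z * z          ≡⟨ λyy≡zz ⟨
    λ' * (y * y)   ≡⟨ cong (λ y → λ' * (y * y)) (λ*y*y≡z*z⇒y≡0 λyy≡zz) ⟩
    λ' * (0# * 0#) ≡⟨ trans (cong (λ' *_) (zeroˡ 0#)) (zeroʳ λ') ⟩
    0#             ∎)

  Hits : Carrier → Carrier → Set
  Hits c y = c ≡ y * y ⊎ c ≡ λ' * (y * y)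

  Edge⇔Hits : ∀ f {x y} → Edge λ' f x y ⇔ Hits (f x) y
  Edge⇔Hits f {x} {y} = mk⇔ to from
    where
    to : Edge λ' f x y → Hits (f x) y
    to e with x*y≡0⇒x≡0⊎y≡0 e
    ... | inj₁ yy-fx≡0 = inj₁ (sym (x-y≡0⇒x≡y yy-fx≡0))
    ... | inj₂ λyy-fx≡0 = inj₂ (sym (x-y≡0⇒x≡y λyy-fx≡0))
    from : Hits (f x) y → Edge λ' f x y
    from (inj₁ fx≡yy) = trans (cong (_* (λ' * (y * y) - f x)) (x≡y⇒x-y≡0 (sym fx≡yy))) (zeroˡ _)
    from (inj₂ fx≡λyy) = trans (cong ((y * y - f x) *_) (x≡y⇒x-y≡0 (sym fx≡λyy))) (zeroʳ _)

  hits-coincide : ∀ {c y t} → t ≢ 0# → Hits c y → Hits c t → y * y ≡ t * t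
  hits-coincide _ (inj₁ c≡yy) (inj₁ c≡tt) = trans (sym c≡yy) c≡tt
  hits-coincide t≢0 (inj₁ c≡yy) (inj₂ c≡λtt) = contradiction (λ*y*y≡z*z⇒y≡0 (trans (sym c≡λtt) c≡yy)) t≢0
  hits-coincide t≢0 (inj₂ c≡λyy) (inj₁ c≡tt) = contradiction (λ*y*y≡z*z⇒z≡0 (trans (sym c≡λyy) c≡tt)) t≢0
  hits-coincide _ (inj₂ c≡λyy) (inj₂ c≡λtt) = *-cancelˡ λ≢0 (trans (sym c≡λyy) c≡λtt)

  -- When IsClosedPair f t holds, the edges leaving t and - t are exactly the edges into {t , - t}.
  IsClosedPair : (Carrier → Carrier) → Carrier → Set
  IsClosedPair f t = t ≢ 0# × f t ≡ t * t × f (- t) ≡ λ' * (t * t)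

  module _ {f : Carrier → Carrier} (f-injective : ∀ {x y} → f x ≡ f y → x ≡ y) where

    closedPair⇒component : 2# ≢ 0# → ∀ {t} → IsClosedPair f t → IsTwoVertexComponent λ' f t (- t)
    closedPair⇒component 2≢0 {t} (t≢0 , ft≡tt , f-t≡λtt) =
      t≢-t , λ w → (λ t~w → EqClosure-preserves S forward backward t~w (inj₁ refl)) , S⇒connected
      where
      S : Carrier → Set
      S w = w ≡ t ⊎ w ≡ - t
      S⇒square : ∀ {y} → S y → y * y ≡ t * t
      S⇒square (inj₁ refl) = refl
      S⇒square (inj₂ refl) = -x*-x≡x*x t
      S⇒hits : ∀ {x} → S x → Hits (f x) t
      S⇒hits (inj₁ refl) = inj₁ ft≡tt
      S⇒hits (inj₂ refl) = inj₂ f-t≡λtt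
      hits⇒S : ∀ {x} → Hits (f x) t → S x
      hits⇒S (inj₁ fx≡tt) = inj₁ (f-injective (trans fx≡tt (sym ft≡tt)))
      hits⇒S (inj₂ fx≡λtt) = inj₂ (f-injective (trans fx≡λtt (sym f-t≡λtt)))
      forward : ∀ {x y} → Edge λ' f x y → S x → S y
      forward e x∈S = x*x≡y*y⇒x≡y⊎x≡-y (hits-coincide t≢0 (Equivalence.to (Edge⇔Hits f) e) (S⇒hits x∈S))
      backward : ∀ {x y} → Edge λ' f x y → S y → S x
      backward {x} e y∈S = hits⇒S (subst (λ s → f x ≡ s ⊎ f x ≡ λ' * s) (S⇒square y∈S) (Equivalence.to (Edge⇔Hits f) e))
      S⇒connected : ∀ {w} → S w → WeaklyConnected λ' f t w
      S⇒connected (inj₁ refl) = ε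
      S⇒connected (inj₂ refl) = fwd (Equivalence.from (Edge⇔Hits f) (inj₁ (trans ft≡tt (sym (-x*-x≡x*x t))))) ◅ ε
      t≢-t : t ≢ - t
      t≢-t t≡-t = x≢0∧y≢0⇒x*y≢0 2≢0 t≢0 (begin
        2# * t   ≡⟨ solve 1 (λ t → # 2 :* t := t :+ t) refl t ⟩
        t + t    ≡⟨ cong (t +_) t≡-t ⟩
        t - t    ≡⟨ -‿inverseʳ t ⟩
        0#       ∎)

    module _ (f-surjective : ∀ c → ∃ λ x → f x ≡ c) (f0≢0 : f 0# ≢ 0#)
             {u v : Carrier} (isComponent : IsTwoVertexComponent λ' f u v) where

      private
        C : Carrier → Set
        C w = w ≡ u ⊎ w ≡ v

        pred∈C : ∀ {x y} → C y → Hits (f x) y → C x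
        pred∈C y∈C fx-hits-y = proj₁ (proj₂ isComponent _)
          (proj₂ (proj₂ isComponent _) y∈C ◅◅ (bwd (Equivalence.from (Edge⇔Hits f) fx-hits-y) ◅ ε))

        f⁻¹ : Carrier → Carrier
        f⁻¹ c = proj₁ (f-surjective c)

        f∘f⁻¹ : ∀ c → f (f⁻¹ c) ≡ c
        f∘f⁻¹ c = proj₂ (f-surjective c)

        f⁻¹-injective : ∀ {c d} → f⁻¹ c ≡ f⁻¹ d → c ≡ d
        f⁻¹-injective {c} {d} e = trans (sym (f∘f⁻¹ c)) (trans (cong f e) (f∘f⁻¹ d))

        square-preimage∈C : ∀ {y} → C y → C (f⁻¹ (y * y))
        square-preimage∈C y∈C = pred∈C y∈C (inj₁ (f∘f⁻¹ _))

        λsquare-preimage∈C : ∀ {y} → C y → C (f⁻¹ (λ' * (y * y)))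
        λsquare-preimage∈C y∈C = pred∈C y∈C (inj₂ (f∘f⁻¹ _))

        preimages-distinct : ∀ {y} → y ≢ 0# → f⁻¹ (y * y) ≢ f⁻¹ (λ' * (y * y))
        preimages-distinct y≢0 e = y≢0 (λ*y*y≡z*z⇒y≡0 (sym (f⁻¹-injective e)))

        -- Otherwise the three distinct points f⁻¹ 0, f⁻¹ (x₀²) and f⁻¹ (λ x₀²) with x₀ = f⁻¹ 0 lie in C.
        0∉C : ∀ {y} → C y → y ≢ 0#
        0∉C y∈C refl = pair-has-no-three-distinct x₀∈C (square-preimage∈C x₀∈C) (λsquare-preimage∈C x₀∈C)
          (λ e → x₀≢0 (x*x≡0⇒x≡0 (sym (f⁻¹-injective e))))
          (λ e → x≢0∧y≢0⇒x*y≢0 λ≢0 (x≢0∧y≢0⇒x*y≢0 x₀≢0 x₀≢0) (sym (f⁻¹-injective e)))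
          (preimages-distinct x₀≢0)
          where
          x₀ = f⁻¹ 0#
          x₀∈C : C x₀
          x₀∈C = pred∈C y∈C (inj₁ (trans (f∘f⁻¹ 0#) (sym (zeroˡ 0#))))
          x₀≢0 : x₀ ≢ 0#
          x₀≢0 x₀≡0 = f0≢0 (trans (cong f (sym x₀≡0)) (f∘f⁻¹ 0#))

        split : ∀ {y} → C y → (f u ≡ y * y × f v ≡ λ' * (y * y)) ⊎ (f v ≡ y * y × f u ≡ λ' * (y * y))
        split y∈C with distinct-pair-members (square-preimage∈C y∈C) (λsquare-preimage∈C y∈C) (preimages-distinct (0∉C y∈C))
        ... | inj₁ (refl , refl) = inj₁ (f∘f⁻¹ _ , f∘f⁻¹ _)
        ... | inj₂ (refl , refl) = inj₂ (f∘f⁻¹ _ , f∘f⁻¹ _)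

        f-u-hits : ∀ {y} → C y → Hits (f u) y
        f-u-hits y∈C with split y∈C
        ... | inj₁ (fu≡yy , _) = inj₁ fu≡yy
        ... | inj₂ (_ , fu≡λyy) = inj₂ fu≡λyy

        u≢0 : u ≢ 0#
        u≢0 = 0∉C (inj₁ refl)

        v≡-u : v ≡ - u
        v≡-u with x*x≡y*y⇒x≡y⊎x≡-y (hits-coincide u≢0 (f-u-hits (inj₂ refl)) (f-u-hits (inj₁ refl)))
        ... | inj₁ v≡u = contradiction (sym v≡u) (proj₁ isComponent)
        ... | inj₂ v≡-u = v≡-u

        closedPair : (f u ≡ u * u × f v ≡ λ' * (u * u)) ⊎ (f v ≡ u * u × f u ≡ λ' * (u * u)) → ∃ (IsClosedPair f)
        closedPair (inj₁ (fu≡uu , fv≡λuu)) = u , u≢0 , fu≡uu , subst (λ w → f w ≡ λ' * (u * u)) v≡-u fv≡λuu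
        closedPair (inj₂ (fv≡uu , fu≡λuu)) = - u , x≢0⇒-x≢0 u≢0 , f-u≡-u-u , f--u≡λ-u-u
          where
          f-u≡-u-u : f (- u) ≡ - u * - u
          f-u≡-u-u = begin
            f (- u)      ≡⟨ cong f v≡-u ⟨
            f v          ≡⟨ fv≡uu ⟩
            u * u        ≡⟨ -x*-x≡x*x u ⟨
            - u * - u    ∎
          f--u≡λ-u-u : f (- - u) ≡ λ' * (- u * - u)
          f--u≡λ-u-u = begin
            f (- - u)          ≡⟨ cong f (-‿involutive u) ⟩
            f u                ≡⟨ fu≡λuu ⟩
            λ' * (u * u)       ≡⟨ cong (λ' *_) (-x*-x≡x*x u) ⟨
            λ' * (- u * - u)   ∎

      component⇒closedPair : ∃ (IsClosedPair f)
      component⇒closedPair = closedPair (split (inj₁ refl))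

module CubicPolynomial {q : ℕ} (F : FiniteField q) (2≢0 : FiniteField.2# F ≢ FiniteField.0# F)
  {λ' : FiniteField.Carrier F} (λ-nonsquare : ¬ FiniteField.IsSquare F λ') (a : FiniteField.Carrier F) where
  open FiniteField F
  open FiniteFieldProperties F
  open NonSquareGraph F λ-nonsquare
  open IntegerCoefficientSolver commutativeRing
  open IsCommutativeRing isCommutativeRing using (*-assoc; distribˡ; zeroʳ)
  open ≡-Reasoning

  cubic : Carrier → Carrier
  cubic x = x * x * x + a

  Condition : Set
  Condition = ¬ (λ' ≡ - 1#) × a ≡ ((λ' + 1#) * (λ' - 1#) * (λ' - 1#)) / 8#

  8≢0 : 8# ≢ 0#
  8≢0 = x≢0∧y≢0⇒x*y≢0 (x≢0∧y≢0⇒x*y≢0 2≢0 2≢0) 2≢0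

  closedPair⇒condition : a ≢ 0# → ∀ {t} → IsClosedPair cubic t → Condition
  closedPair⇒condition a≢0 {t} (t≢0 , ct≡tt , c-t≡λtt) = λ≢-1 , Equivalence.from (x≡y/z⇔z*x≡y 8≢0) 8a≡
    where
    2a≡[λ+1]tt : 2# * a ≡ (λ' + 1#) * (t * t)
    2a≡[λ+1]tt = begin
      2# * a                        ≡⟨ solve 2 (λ t a → # 2 :* a := (t :* t :* t :+ a) :+ (:- t :* :- t :* :- t :+ a)) refl t a ⟩
      cubic t + cubic (- t)         ≡⟨ cong₂ _+_ ct≡tt c-t≡λtt ⟩
      t * t + λ' * (t * t)          ≡⟨ solve 2 (λ t l → t :* t :+ l :* (t :* t) := (l :+ # 1) :* (t :* t)) refl t λ' ⟩
      (λ' + 1#) * (t * t)           ∎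
    2t≡1-λ : 2# * t ≡ 1# - λ'
    2t≡1-λ = *-cancelˡ (x≢0∧y≢0⇒x*y≢0 t≢0 t≢0) (begin
      t * t * (2# * t)              ≡⟨ solve 2 (λ t a → t :* t :* (# 2 :* t) := (t :* t :* t :+ a) :- (:- t :* :- t :* :- t :+ a)) refl t a ⟩
      cubic t - cubic (- t)         ≡⟨ cong₂ _-_ ct≡tt c-t≡λtt ⟩
      t * t - λ' * (t * t)          ≡⟨ solve 2 (λ t l → t :* t :- l :* (t :* t) := t :* t :* (# 1 :- l)) refl t λ' ⟩
      t * t * (1# - λ')             ∎)
    λ≢-1 : λ' ≢ - 1#
    λ≢-1 λ≡-1 = x≢0∧y≢0⇒x*y≢0 2≢0 a≢0 (begin
      2# * a                        ≡⟨ 2a≡[λ+1]tt ⟩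
      (λ' + 1#) * (t * t)           ≡⟨ cong (λ l → (l + 1#) * (t * t)) λ≡-1 ⟩
      (- 1# + 1#) * (t * t)         ≡⟨ solve 1 (λ t → (:- # 1 :+ # 1) :* (t :* t) := # 0) refl t ⟩
      0#                            ∎)
    8a≡ : 8# * a ≡ (λ' + 1#) * (λ' - 1#) * (λ' - 1#)
    8a≡ = begin
      8# * a                               ≡⟨ *-assoc (2# * 2#) 2# a ⟩
      2# * 2# * (2# * a)                   ≡⟨ cong (2# * 2# *_) 2a≡[λ+1]tt ⟩
      2# * 2# * ((λ' + 1#) * (t * t))      ≡⟨ solve 2 (λ l t → # 2 :* # 2 :* ((l :+ # 1) :* (t :* t)) := (l :+ # 1) :* (# 2 :* t) :* (# 2 :* t)) refl λ' t ⟩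
      (λ' + 1#) * (2# * t) * (2# * t)      ≡⟨ cong (λ s → (λ' + 1#) * s * s) 2t≡1-λ ⟩
      (λ' + 1#) * (1# - λ') * (1# - λ')    ≡⟨ solve 1 (λ l → (l :+ # 1) :* (# 1 :- l) :* (# 1 :- l) := (l :+ # 1) :* (l :- # 1) :* (l :- # 1)) refl λ' ⟩
      (λ' + 1#) * (λ' - 1#) * (λ' - 1#)    ∎

  condition⇒closedPair : Condition → IsClosedPair cubic ((1# - λ') / 2#)
  condition⇒closedPair (_ , a≡[λ+1][λ-1]²/8) = t≢0 , ct≡tt , c-t≡λtt
    where
    t = (1# - λ') / 2#
    2t≡1-λ : 2# * t ≡ 1# - λ'
    2t≡1-λ = Equivalence.to (x≡y/z⇔z*x≡y 2≢0) refl
    λ≡1-2t : λ' ≡ 1# - 2# * t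
    λ≡1-2t = trans (solve 1 (λ l → l := # 1 :- (# 1 :- l)) refl λ') (cong (λ s → 1# - s) (sym 2t≡1-λ))
    8a≡ : 8# * a ≡ (1# - 2# * t + 1#) * (1# - 2# * t - 1#) * (1# - 2# * t - 1#)
    8a≡ = trans (Equivalence.to (x≡y/z⇔z*x≡y 8≢0) a≡[λ+1][λ-1]²/8) (cong (λ l → (l + 1#) * (l - 1#) * (l - 1#)) λ≡1-2t)
    t≢0 : t ≢ 0#
    t≢0 t≡0 = λ≢1 (sym (x-y≡0⇒x≡y (trans (sym 2t≡1-λ) (trans (cong (2# *_) t≡0) (zeroʳ 2#)))))
    ct≡tt : cubic t ≡ t * t
    ct≡tt = *-cancelˡ 8≢0 (begin
      8# * (t * t * t + a)                  ≡⟨ distribˡ 8# (t * t * t) a ⟩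
      8# * (t * t * t) + 8# * a             ≡⟨ cong (8# * (t * t * t) +_) 8a≡ ⟩
      8# * (t * t * t) + (1# - 2# * t + 1#) * (1# - 2# * t - 1#) * (1# - 2# * t - 1#)
        ≡⟨ solve 1 (λ t → # 2 :* # 2 :* # 2 :* (t :* t :* t) :+ (# 1 :- # 2 :* t :+ # 1) :* (# 1 :- # 2 :* t :- # 1) :* (# 1 :- # 2 :* t :- # 1)
                        := # 2 :* # 2 :* # 2 :* (t :* t)) refl t ⟩
      8# * (t * t)                          ∎)
    c-t≡λtt : cubic (- t) ≡ λ' * (t * t)
    c-t≡λtt = *-cancelˡ 8≢0 (begin
      8# * (- t * - t * - t + a)            ≡⟨ distribˡ 8# (- t * - t * - t) a ⟩
      8# * (- t * - t * - t) + 8# * a       ≡⟨ cong (8# * (- t * - t * - t) +_) 8a≡ ⟩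
      8# * (- t * - t * - t) + (1# - 2# * t + 1#) * (1# - 2# * t - 1#) * (1# - 2# * t - 1#)
        ≡⟨ solve 1 (λ t → # 2 :* # 2 :* # 2 :* (:- t :* :- t :* :- t) :+ (# 1 :- # 2 :* t :+ # 1) :* (# 1 :- # 2 :* t :- # 1) :* (# 1 :- # 2 :* t :- # 1)
                        := # 2 :* # 2 :* # 2 :* ((# 1 :- # 2 :* t) :* (t :* t))) refl t ⟩
      8# * ((1# - 2# * t) * (t * t))        ≡⟨ cong (λ l → 8# * (l * (t * t))) λ≡1-2t ⟨
      8# * (λ' * (t * t))                   ∎)

proposition6p4 : (q : ℕ) → IsOddPrimePower q → ¬ (3 ∣ q ∸ 1) → (F : FiniteField q) →
    let open FiniteField F in
    (λ' : Carrier) → ¬ IsSquare λ' → (a : Carrier) → ¬ (a ≡ 0#) →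
      (HasTwoVertexComponent λ' (λ x → x * x * x + a)
        ⇔ (¬ (λ' ≡ - 1#) × a ≡ ((λ' + 1#) * (λ' - 1#) * (λ' - 1#)) / 8#))
      × ((¬ (λ' ≡ - 1#) × a ≡ ((λ' + 1#) * (λ' - 1#) * (λ' - 1#)) / 8#) →
          IsTwoVertexComponent λ' (λ x → x * x * x + a) ((1# - λ') / 2#) ((λ' - 1#) / 2#))
proposition6p4 q q-odd 3∤q-1 F λ' λ-nonsquare a a≢0 =
  mk⇔ (λ (_ , _ , isComponent) → necessity isComponent) (λ condition → _ , _ , sufficiency condition) , sufficiency
  where
  open FiniteField F
  open FiniteFieldProperties F
  open NonSquareGraph F λ-nonsquare
  open CubicPolynomial F (2#≢0# q-odd) λ-nonsquare a
  open IntegerCoefficientSolver commutativeRing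
  open import Algebra.Properties.Ring (CommutativeRing.ring commutativeRing) using (+-cancelʳ)

  cubic-injective : ∀ {x y} → cubic x ≡ cubic y → x ≡ y
  cubic-injective = cube-injective 3∤q-1 ∘ +-cancelʳ a _ _

  cubic0≢0 : cubic 0# ≢ 0#
  cubic0≢0 = a≢0 ∘ trans (solve 1 (λ a → a := # 0 :* # 0 :* # 0 :+ a) refl a)

  necessity : ∀ {u v} → IsTwoVertexComponent λ' cubic u v → Condition
  necessity = closedPair⇒condition a≢0 ∘ proj₂
            ∘ component⇒closedPair cubic-injective (injective⇒surjective cubic-injective) cubic0≢0

  sufficiency : Condition → IsTwoVertexComponent λ' cubic ((1# - λ') / 2#) ((λ' - 1#) / 2#)
  sufficiency condition = subst (IsTwoVertexComponent λ' cubic ((1# - λ') / 2#)) -[1-λ]/2≡[λ-1]/2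
    (closedPair⇒component cubic-injective (2#≢0# q-odd) (condition⇒closedPair condition))
    where
    -[1-λ]/2≡[λ-1]/2 : - ((1# - λ') / 2#) ≡ (λ' - 1#) / 2#
    -[1-λ]/2≡[λ-1]/2 = solve 2 (λ l h → :- ((# 1 :- l) :* h) := (l :- # 1) :* h) refl λ' (2# ⁻¹)
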